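{- If $G$ and $H$ are connected graphs, then $S(G\boxtimes H)=S(G)\times S(H)$.
   Context: All graphs are finite and simple. A vertex is simplicial if its open neighbourhood induces a complete subgraph; $S(G)$ is the set of simplicial vertices of $G$. The strong product $G\boxtimes H$ has vertex set $V(G)\times V(H)$, with $(g,h)$ and $(g',h')$ adjacent iff either $g=g'$ and $hh'\in E(H)$, or $gg'\in E(G)$ and $h=h'$, or $gg'\in E(G)$ and $hh'\in E(H)$. -}

module Defs where

open import Level using (0ℓ)
open import Data.Nat using (ℕ; _≥_)
open import Data.Fin using (Fin)
open import Data.Product using (_×_; _,_; proj₁; proj₂)
open import Data.Sum using (_⊎_)
open import Relation.Binary.PropositionalEquality using (_≡_)
open import Relation.Binary.Construct.Closure.ReflexiveTransitive using (Star)
open import Relation.Nullary using (¬_)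

record Graph : Set₁ where
  field
    n      : ℕ
    Adj    : Fin n → Fin n → Set
    sym    : ∀ {x y} → Adj x y → Adj y x
    irrefl : ∀ {x} → ¬ Adj x x
open Graph public

Vertex : Graph → Set
Vertex G = Fin (n G)

Connected : Graph → Set
Connected G = (n G ≥ 1) × (∀ (x y : Vertex G) → Star (Adj G) x y)

Simplicial : (G : Graph) → Vertex G → Set
Simplicial G v = ∀ (x y : Vertex G) → Adj G v x → Adj G v y → ¬ x ≡ y → Adj G x y

StrongAdj : (G H : Graph) → Vertex G × Vertex H → Vertex G × Vertex H → Set
StrongAdj G H (g , h) (g' , h') =
    (g ≡ g' × Adj H h h')
  ⊎ (Adj G g g' × h ≡ h')
  ⊎ (Adj G g g' × Adj H h h')

SimplicialProd : (G H : Graph) → Vertex G × Vertex H → Set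
SimplicialProd G H v =
  ∀ (x y : Vertex G × Vertex H) → StrongAdj G H v x → StrongAdj G H v y → ¬ x ≡ y → StrongAdj G H x y

-- For distinct vertices, adjacency in G ⊠ H is exactly "equal or adjacent" in
-- both coordinates, and v is simplicial iff any two members of its closed
-- neighbourhood are equal or adjacent; so the closed neighbourhood of (g , h) is
-- a clique iff those of g and h are.

module Submission where

open import Defs
open import Data.Product using (_×_; _,_; proj₁; proj₂)
open import Data.Sum using (inj₁; inj₂)
open import Data.Fin using (_≟_)
open import Data.Empty using (⊥-elim)
open import Relation.Nullary using (yes; no; ¬_)
open import Relation.Binary.PropositionalEquality using (_≡_; refl; cong)
open import Relation.Binary.Construct.Closure.Reflexive as Refl using (ReflClosure; [_])
open import Function.Bundles using (_⇔_; mk⇔)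

AdjOrEq : (G : Graph) → Vertex G → Vertex G → Set
AdjOrEq G = ReflClosure (Adj G)

simplicial⇒closedNbhd-clique : (G : Graph) {v a c : Vertex G} → Simplicial G v →
  AdjOrEq G v a → AdjOrEq G v c → AdjOrEq G a c
simplicial⇒closedNbhd-clique G s Refl.refl v~c       = v~c
simplicial⇒closedNbhd-clique G s [ v~a ]  Refl.refl = [ sym G v~a ]
simplicial⇒closedNbhd-clique G {a = a} {c} s [ v~a ] [ v~c ] with a ≟ c
... | yes refl = Refl.refl
... | no a≢c   = [ s a c v~a v~c a≢c ]

strongAdj⇒adjOrEq× : (G H : Graph) {g a : Vertex G} {h b : Vertex H} →
  StrongAdj G H (g , h) (a , b) → AdjOrEq G g a × AdjOrEq H h b
strongAdj⇒adjOrEq× G H (inj₁ (refl , h~b))         = Refl.refl , [ h~b ]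
strongAdj⇒adjOrEq× G H (inj₂ (inj₁ (g~a , refl))) = [ g~a ] , Refl.refl
strongAdj⇒adjOrEq× G H (inj₂ (inj₂ (g~a , h~b))) = [ g~a ] , [ h~b ]

adjOrEq×⇒strongAdj : (G H : Graph) {a c : Vertex G} {b d : Vertex H} →
  AdjOrEq G a c → AdjOrEq H b d → ¬ (a , b) ≡ (c , d) → StrongAdj G H (a , b) (c , d)
adjOrEq×⇒strongAdj G H Refl.refl Refl.refl ab≢cd = ⊥-elim (ab≢cd refl)
adjOrEq×⇒strongAdj G H Refl.refl [ b~d ]   _     = inj₁ (refl , b~d)
adjOrEq×⇒strongAdj G H [ a~c ]   Refl.refl _     = inj₂ (inj₁ (a~c , refl))
adjOrEq×⇒strongAdj G H [ a~c ]   [ b~d ]   _     = inj₂ (inj₂ (a~c , b~d))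

simplicialProd⇒simplicialˡ : (G H : Graph) {g : Vertex G} {h : Vertex H} →
  SimplicialProd G H (g , h) → Simplicial G g
simplicialProd⇒simplicialˡ G H {h = h} s x y g~x g~y x≢y
  with s (x , h) (y , h) (inj₂ (inj₁ (g~x , refl))) (inj₂ (inj₁ (g~y , refl)))
         (λ xh≡yh → x≢y (cong proj₁ xh≡yh))
... | inj₁ (x≡y , _)         = ⊥-elim (x≢y x≡y)
... | inj₂ (inj₁ (x~y , _)) = x~y
... | inj₂ (inj₂ (_ , h~h)) = ⊥-elim (irrefl H h~h)

simplicialProd⇒simplicialʳ : (G H : Graph) {g : Vertex G} {h : Vertex H} →
  SimplicialProd G H (g , h) → Simplicial H h
simplicialProd⇒simplicialʳ G H {g} s x y h~x h~y x≢y
  with s (g , x) (g , y) (inj₁ (refl , h~x)) (inj₁ (refl , h~y))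
         (λ gx≡gy → x≢y (cong proj₂ gx≡gy))
... | inj₁ (_ , x~y)         = x~y
... | inj₂ (inj₁ (g~g , _)) = ⊥-elim (irrefl G g~g)
... | inj₂ (inj₂ (g~g , _)) = ⊥-elim (irrefl G g~g)

simplicial×⇒simplicialProd : (G H : Graph) {g : Vertex G} {h : Vertex H} →
  Simplicial G g → Simplicial H h → SimplicialProd G H (g , h)
simplicial×⇒simplicialProd G H sg sh (a , b) (c , d) v~ab v~cd ab≢cd
  with strongAdj⇒adjOrEq× G H v~ab | strongAdj⇒adjOrEq× G H v~cd
... | g~a , h~b | g~c , h~d =
  adjOrEq×⇒strongAdj G H (simplicial⇒closedNbhd-clique G sg g~a g~c)
                         (simplicial⇒closedNbhd-clique H sh h~b h~d) ab≢cd

lemma4p1 : (G H : Graph) → Connected G → Connected H →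
    (v : Vertex G × Vertex H) →
      SimplicialProd G H v ⇔ (Simplicial G (proj₁ v) × Simplicial H (proj₂ v))
lemma4p1 G H _ _ (g , h) = mk⇔
  (λ s → simplicialProd⇒simplicialˡ G H s , simplicialProd⇒simplicialʳ G H s)
  (λ (sg , sh) → simplicial×⇒simplicialProd G H sg sh)
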